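{- For any positive integers $k,n$ with $1\le k\le n-1$, \[ \mathcal{M}(k,n)\le \Big(\sum_{j=1}^{k} b_j\Big)\cdot n, \] where $(b_j)_{j\ge1}=(1,\tfrac12,\tfrac12,\tfrac13,\tfrac13,\tfrac13,\tfrac14,\tfrac14,\tfrac14,\tfrac14,\dots)$ is the sequence in which, for each $t\ge1$, the value $1/t$ appears $t$ consecutive times.
   Context: $s_k=(k\ k{+}1)\in S_n$, $w_0=n\,(n-1)\cdots 2\,1$ is the longest permutation of $S_n$, and $\mathcal{M}(k,n)$ is the maximum number of occurrences of $s_k$ in a reduced word of $w_0$. -}

module Defs where

open import Data.Nat using (ℕ; zero; suc; _≤_; _<_; _∸_; _≟_)
open import Data.List using (List; []; _∷_; length; foldl; foldr; reverse; upTo; map; concat; replicate; take)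
open import Data.List.Relation.Unary.All using (All)
open import Data.Product using (_×_)
open import Data.Integer using (+_)
open import Data.Rational using (ℚ; _/_; _+_; 0ℚ)
open import Relation.Nullary using (yes; no)

-- Permutations of {1..n} in one-line notation, as lists of naturals.
-- Identity of S_n : [1, 2, ..., n]
idPerm : ℕ → List ℕ
idPerm n = map suc (upTo n)

w0 : ℕ → List ℕ
w0 n = reverse (idPerm n)

-- Right multiplication by s_i = (i i+1): swap entries at positions i, i+1 (1-indexed).
swapAt : ℕ → List ℕ → List ℕ
swapAt (suc zero) (x ∷ y ∷ xs) = y ∷ x ∷ xs
swapAt (suc (suc i)) (x ∷ xs) = x ∷ swapAt (suc i) xs
swapAt _ xs = xs

IsWordIn : ℕ → List ℕ → Set
IsWordIn n w = All (λ i → 1 ≤ i × i < n) w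

evalWord : ℕ → List ℕ → List ℕ
evalWord n w = foldl (λ p i → swapAt i p) (idPerm n) w

IsWordFor-w0 : ℕ → List ℕ → Set
IsWordFor-w0 n w = IsWordIn n w × evalWord n w Relation.Binary.PropositionalEquality.≡ w0 n
  where import Relation.Binary.PropositionalEquality

IsReducedWord-w0 : ℕ → List ℕ → Set
IsReducedWord-w0 n w = IsWordFor-w0 n w × (∀ v → IsWordFor-w0 n v → length w ≤ length v)

occurrences : ℕ → List ℕ → ℕ
occurrences k [] = 0
occurrences k (i ∷ w) with i ≟ k
... | yes _ = suc (occurrences k w)
... | no _ = occurrences k w

-- b = (1, 1/2, 1/2, 1/3, 1/3, 1/3, ...): for each t ≥ 1, 1/t repeated t times.
-- bBlocks m = [1; 1/2,1/2; ...; 1/m,...,1/m]  (has m(m+1)/2 ≥ m entries)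
bBlocks : ℕ → List ℚ
bBlocks m = concat (map (λ t → replicate (suc t) (+ 1 / suc t)) (upTo m))

sumB : ℕ → ℚ
sumB k = foldr _+_ 0ℚ (take k (bBlocks k))

-- A reduced word of w0 has as many letters as w0 has inversions, so each letter sᵢ of it swaps an ascent
-- x < y at positions i, i + 1 of the current permutation, starting from the identity. For t ≥ 1 let
--   Φₜ(p) = (p₁ + ⋯ + pₖ) + Σ_{δ=1}^{t} (t − δ) · #{inversions of p whose values differ by δ}.
-- No letter decreases Φₜ, and a letter sₖ raises the prefix sum by the gap d = y − x while creating an
-- inversion of gap d, so it raises Φₜ by at least d + (t − d) ≥ t. As w0 has prefix sums at most k n and at
-- most n inversions of each gap, t · 𝓜(k, n) ≤ Φₜ(w0) ≤ (k + t(t − 1)/2) · n. Writing k = m(m + 1)/2 + r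
-- with 1 ≤ r ≤ m + 1 and choosing t = m + 1 gives 𝓜(k, n) ≤ (m + r/(m + 1)) · n = (b₁ + ⋯ + bₖ) · n.

module Submission where

open import Data.Bool.Base using (Bool; true; false; T)
open import Data.Empty using (⊥; ⊥-elim)
open import Data.Integer.Base as ℤ using ()
open import Data.List.Base using (List; []; _∷_; [_]; _++_; length; map; reverse; take; replicate; concat; upTo; applyUpTo; foldl; foldr)
open import Data.List.Properties using (upTo-∷ʳ; map-++; reverse-++; foldl-++; length-++; length-map; length-upTo; unfold-reverse; map-upTo; concat-++; ++-assoc; ++-identityʳ; length-replicate)
open import Data.List.Relation.Unary.All as All using (All; []; _∷_)
open import Data.List.Relation.Unary.All.Properties using (++⁺; map⁺)
open import Data.Nat.Base hiding (_/_)
open import Data.Nat.ListAction using (sum)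
open import Data.Nat.Properties
open import Data.Nat.Solver using (module +-*-Solver)
open import Data.Rational.Base as ℚ using (ℚ; _/_; 0ℚ; 1ℚ; toℚᵘ)
open import Data.Rational.Properties using (toℚᵘ-injective; toℚᵘ-fromℚᵘ; toℚᵘ-homo-+; toℚᵘ-homo-*; toℚᵘ-cancel-≤; *-cancelˡ-≤-pos; normalize-pos)
import Data.Rational.Properties as ℚ
import Data.Rational.Unnormalised.Base as ℚᵘ
import Data.Rational.Unnormalised.Properties as ℚᵘ
import Data.Integer.Properties as ℤ
open import Data.Product.Base using (Σ; ∃₂; _×_; _,_; proj₁; proj₂)
open import Data.Sum.Base using (_⊎_; inj₁; inj₂)
open import Data.Unit.Base using (⊤; tt)
open import Function.Base using (_∘_)
open import Relation.Binary.PropositionalEquality hiding ([_])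
open import Relation.Nullary using (¬_; yes; no)

open import Defs

open +-*-Solver

𝟙 : Bool → ℕ
𝟙 true  = 1
𝟙 false = 0

𝟙-true : ∀ {b} → T b → 𝟙 b ≡ 1
𝟙-true {true} _ = refl

𝟙-false : ∀ {b} → ¬ T b → 𝟙 b ≡ 0
𝟙-false {false} _  = refl
𝟙-false {true}  ¬t = ⊥-elim (¬t tt)

countᵇ : (ℕ → Bool) → List ℕ → ℕ
countᵇ f []       = 0
countᵇ f (y ∷ ys) = 𝟙 (f y) + countᵇ f ys

pairCount : (ℕ → ℕ → Bool) → List ℕ → ℕ
pairCount R []       = 0
pairCount R (x ∷ xs) = countᵇ (R x) xs + pairCount R xs

countᵇ-swapAt : ∀ f i xs → countᵇ f (swapAt i xs) ≡ countᵇ f xs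
countᵇ-swapAt f zero                xs           = refl
countᵇ-swapAt f (suc zero)          []           = refl
countᵇ-swapAt f (suc zero)          (x ∷ [])     = refl
countᵇ-swapAt f (suc zero)          (x ∷ y ∷ xs) =
  solve 3 (λ a b c → a :+ (b :+ c) := b :+ (a :+ c)) refl (𝟙 (f y)) (𝟙 (f x)) (countᵇ f xs)
countᵇ-swapAt f (suc (suc i))       []           = refl
countᵇ-swapAt f (suc (suc i))       (x ∷ xs)     = cong (𝟙 (f x) +_) (countᵇ-swapAt f (suc i) xs)

pairCount-swap-head : ∀ R a b zs →
  pairCount R (b ∷ a ∷ zs) + 𝟙 (R a b) ≡ pairCount R (a ∷ b ∷ zs) + 𝟙 (R b a)
pairCount-swap-head R a b zs =
  solve 5 (λ rba cb ca P rab → ((rba :+ cb) :+ (ca :+ P)) :+ rab := ((rab :+ ca) :+ (cb :+ P)) :+ rba)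
    refl (𝟙 (R b a)) (countᵇ (R b) zs) (countᵇ (R a) zs) (pairCount R zs) (𝟙 (R a b))

-- Positions are 1-indexed, as in swapAt.
Ascent : ℕ → List ℕ → Set
Ascent zero          _            = ⊥
Ascent (suc zero)    (x ∷ y ∷ _)  = x < y
Ascent (suc zero)    _            = ⊥
Ascent (suc (suc i)) []           = ⊥
Ascent (suc (suc i)) (_ ∷ xs)     = Ascent (suc i) xs

-- Swapping turns the adjacent entries low, high into high, low; no other pair of positions changes order.
record AscentSwap (i : ℕ) (p : List ℕ) : Set where
  field
    low high          : ℕ
    low<high          : low < high
    pairCount-swapAt  : ∀ R → pairCount R (swapAt i p) + 𝟙 (R low high) ≡ pairCount R p + 𝟙 (R high low)
    sum-take-swapAt   : sum (take i (swapAt i p)) + low ≡ sum (take i p) + high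
    sum-take-swapAt-≢ : ∀ j → j ≢ i → sum (take j (swapAt i p)) ≡ sum (take j p)

open AscentSwap

ascentSwap : ∀ i p → Ascent i p → AscentSwap i p
ascentSwap (suc zero) (a ∷ b ∷ zs) a<b = record
  { low = a ; high = b ; low<high = a<b
  ; pairCount-swapAt = λ R → pairCount-swap-head R a b zs
  ; sum-take-swapAt = solve 2 (λ a b → (b :+ con 0) :+ a := (a :+ con 0) :+ b) refl a b
  ; sum-take-swapAt-≢ = sum-take-≢ }
  where
  sum-take-≢ : ∀ j → j ≢ 1 → sum (take j (b ∷ a ∷ zs)) ≡ sum (take j (a ∷ b ∷ zs))
  sum-take-≢ zero          _   = refl
  sum-take-≢ (suc zero)    j≢1 = ⊥-elim (j≢1 refl)
  sum-take-≢ (suc (suc j)) _   = solve 3 (λ a b c → b :+ (a :+ c) := a :+ (b :+ c)) refl a b (sum (take j zs))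
ascentSwap (suc (suc i)) (z ∷ xs) asc = record
  { low = low s ; high = high s ; low<high = low<high s
  ; pairCount-swapAt = pairCount-cons
  ; sum-take-swapAt = trans (+-assoc z _ _) (trans (cong (z +_) (sum-take-swapAt s)) (sym (+-assoc z _ _)))
  ; sum-take-swapAt-≢ = sum-take-≢ }
  where
  s = ascentSwap (suc i) xs asc
  pairCount-cons : ∀ R → pairCount R (z ∷ swapAt (suc i) xs) + 𝟙 (R (low s) (high s))
                       ≡ pairCount R (z ∷ xs) + 𝟙 (R (high s) (low s))
  pairCount-cons R = begin
    countᵇ (R z) (swapAt (suc i) xs) + pairCount R (swapAt (suc i) xs) + 𝟙 (R (low s) (high s))
      ≡⟨ cong (λ c → c + pairCount R (swapAt (suc i) xs) + 𝟙 (R (low s) (high s))) (countᵇ-swapAt (R z) (suc i) xs) ⟩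
    countᵇ (R z) xs + pairCount R (swapAt (suc i) xs) + 𝟙 (R (low s) (high s))
      ≡⟨ +-assoc (countᵇ (R z) xs) _ _ ⟩
    countᵇ (R z) xs + (pairCount R (swapAt (suc i) xs) + 𝟙 (R (low s) (high s)))
      ≡⟨ cong (countᵇ (R z) xs +_) (pairCount-swapAt s R) ⟩
    countᵇ (R z) xs + (pairCount R xs + 𝟙 (R (high s) (low s)))
      ≡⟨ +-assoc (countᵇ (R z) xs) _ _ ⟨
    countᵇ (R z) xs + pairCount R xs + 𝟙 (R (high s) (low s)) ∎
    where open ≡-Reasoning
  sum-take-≢ : ∀ j → j ≢ suc (suc i) → sum (take j (z ∷ swapAt (suc i) xs)) ≡ sum (take j (z ∷ xs))
  sum-take-≢ zero    _ = refl
  sum-take-≢ (suc j) j≢ = cong (z +_) (sum-take-swapAt-≢ s j (j≢ ∘ cong suc))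

inversions : List ℕ → ℕ
inversions = pairCount (λ a b → b <ᵇ a)

inversions-swapAt-ascent : ∀ i p (s : AscentSwap i p) → inversions (swapAt i p) ≡ suc (inversions p)
inversions-swapAt-ascent i p s = +-cancelʳ-≡ _ _ _ (begin
  inversions (swapAt i p) + 𝟙 (high s <ᵇ low s)   ≡⟨ pairCount-swapAt s (λ a b → b <ᵇ a) ⟩
  inversions p + 𝟙 (low s <ᵇ high s)              ≡⟨ cong (inversions p +_) (𝟙-true (<⇒<ᵇ (low<high s))) ⟩
  inversions p + 1                                ≡⟨ +-comm (inversions p) 1 ⟩
  suc (inversions p)                              ≡⟨ +-identityʳ _ ⟨
  suc (inversions p) + 0                          ≡⟨ cong (suc (inversions p) +_) (𝟙-false ¬high<low) ⟨
  suc (inversions p) + 𝟙 (high s <ᵇ low s)        ∎)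
  where
  open ≡-Reasoning
  ¬high<low : ¬ T (high s <ᵇ low s)
  ¬high<low t = <-asym (low<high s) (<ᵇ⇒< _ _ t)

ascent⊎inversions-swapAt-≤ : ∀ i p → Ascent i p ⊎ inversions (swapAt i p) ≤ inversions p
ascent⊎inversions-swapAt-≤ zero          p            = inj₂ ≤-refl
ascent⊎inversions-swapAt-≤ (suc zero)    []           = inj₂ ≤-refl
ascent⊎inversions-swapAt-≤ (suc zero)    (a ∷ [])     = inj₂ ≤-refl
ascent⊎inversions-swapAt-≤ (suc zero)    (a ∷ b ∷ zs) with a <? b
... | yes a<b = inj₁ a<b
... | no  a≮b = inj₂ (m+n≤o⇒m≤o _ (≤-reflexive (begin
  inversions (b ∷ a ∷ zs) + 𝟙 (b <ᵇ a)   ≡⟨ pairCount-swap-head (λ a b → b <ᵇ a) a b zs ⟩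
  inversions (a ∷ b ∷ zs) + 𝟙 (a <ᵇ b)   ≡⟨ cong (inversions (a ∷ b ∷ zs) +_) (𝟙-false (a≮b ∘ <ᵇ⇒< a b)) ⟩
  inversions (a ∷ b ∷ zs) + 0            ≡⟨ +-identityʳ _ ⟩
  inversions (a ∷ b ∷ zs)                ∎)))
  where open ≡-Reasoning
ascent⊎inversions-swapAt-≤ (suc (suc i)) []           = inj₂ ≤-refl
ascent⊎inversions-swapAt-≤ (suc (suc i)) (z ∷ xs) with ascent⊎inversions-swapAt-≤ (suc i) xs
... | inj₁ asc = inj₁ asc
... | inj₂ inv≤ = inj₂ (+-mono-≤ (≤-reflexive (countᵇ-swapAt _ (suc i) xs)) inv≤)

applyWord : List ℕ → List ℕ → List ℕ
applyWord = foldl (λ p i → swapAt i p)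

AscentWord : List ℕ → List ℕ → Set
AscentWord p []      = ⊤
AscentWord p (i ∷ w) = Ascent i p × AscentWord (swapAt i p) w

+-inversions-swapAt-ascent : ∀ (w : List ℕ) i p → Ascent i p →
  length w + inversions (swapAt i p) ≡ suc (length w + inversions p)
+-inversions-swapAt-ascent w i p asc =
  trans (cong (length w +_) (inversions-swapAt-ascent i p (ascentSwap i p asc))) (+-suc (length w) (inversions p))

inversions-applyWord-≤ : ∀ p w → inversions (applyWord p w) ≤ length w + inversions p
inversions-applyWord-≤ p []      = ≤-refl
inversions-applyWord-≤ p (i ∷ w) with ascent⊎inversions-swapAt-≤ i p
... | inj₁ asc = ≤-trans (inversions-applyWord-≤ (swapAt i p) w) (≤-reflexive (+-inversions-swapAt-ascent w i p asc))
... | inj₂ inv≤ = ≤-trans (inversions-applyWord-≤ (swapAt i p) w) (m≤n⇒m≤1+n (+-monoʳ-≤ (length w) inv≤))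

tight⇒AscentWord : ∀ p w → length w + inversions p ≤ inversions (applyWord p w) → AscentWord p w
tight⇒AscentWord p []      _     = tt
tight⇒AscentWord p (i ∷ w) tight with ascent⊎inversions-swapAt-≤ i p
... | inj₁ asc = asc , tight⇒AscentWord (swapAt i p) w
                        (≤-trans (≤-reflexive (+-inversions-swapAt-ascent w i p asc)) tight)
... | inj₂ inv≤ = ⊥-elim (<-irrefl refl (≤-trans tight
  (≤-trans (inversions-applyWord-≤ (swapAt i p) w) (+-monoʳ-≤ (length w) inv≤))))

w0-suc : ∀ n → w0 (suc n) ≡ suc n ∷ w0 n
w0-suc n = begin
  reverse (map suc (upTo (suc n)))         ≡⟨ cong (reverse ∘ map suc) (upTo-∷ʳ n) ⟨
  reverse (map suc (upTo n ++ [ n ]))      ≡⟨ cong reverse (map-++ suc (upTo n) [ n ]) ⟩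
  reverse (map suc (upTo n) ++ [ suc n ])  ≡⟨ reverse-++ (map suc (upTo n)) [ suc n ] ⟩
  suc n ∷ w0 n                             ∎
  where open ≡-Reasoning

w0-≤ : ∀ n → All (_≤ n) (w0 n)
w0-≤ zero    = []
w0-≤ (suc n) rewrite w0-suc n = ≤-refl ∷ All.map m≤n⇒m≤1+n (w0-≤ n)

length-w0 : ∀ n → length (w0 n) ≡ n
length-w0 zero    = refl
length-w0 (suc n) rewrite w0-suc n = cong suc (length-w0 n)

countᵇ-<ᵇ-All : ∀ c xs → All (_< c) xs → countᵇ (_<ᵇ c) xs ≡ length xs
countᵇ-<ᵇ-All c []       []       = refl
countᵇ-<ᵇ-All c (x ∷ xs) (h ∷ hs) = cong₂ _+_ (𝟙-true (<⇒<ᵇ h)) (countᵇ-<ᵇ-All c xs hs)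

inversions-w0-suc : ∀ n → inversions (w0 (suc n)) ≡ n + inversions (w0 n)
inversions-w0-suc n rewrite w0-suc n =
  cong (_+ inversions (w0 n)) (trans (countᵇ-<ᵇ-All (suc n) (w0 n) (All.map s≤s (w0-≤ n))) (length-w0 n))

countᵇ-map-suc : ∀ f xs → countᵇ f (map suc xs) ≡ countᵇ (f ∘ suc) xs
countᵇ-map-suc f []       = refl
countᵇ-map-suc f (x ∷ xs) = cong (𝟙 (f (suc x)) +_) (countᵇ-map-suc f xs)

inversions-map-suc : ∀ xs → inversions (map suc xs) ≡ inversions xs
inversions-map-suc []       = refl
inversions-map-suc (x ∷ xs) = cong₂ _+_ (countᵇ-map-suc (_<ᵇ suc x) xs) (inversions-map-suc xs)

countᵇ-<ᵇ-0 : ∀ xs → countᵇ (_<ᵇ 0) xs ≡ 0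
countᵇ-<ᵇ-0 []       = refl
countᵇ-<ᵇ-0 (x ∷ xs) = countᵇ-<ᵇ-0 xs

inversions-upTo : ∀ n → inversions (upTo n) ≡ 0
inversions-upTo zero    = refl
inversions-upTo (suc n) = cong₂ _+_ (countᵇ-<ᵇ-0 (applyUpTo suc n)) (begin
  inversions (applyUpTo suc n)  ≡⟨ cong inversions (map-upTo suc n) ⟨
  inversions (map suc (upTo n)) ≡⟨ inversions-map-suc (upTo n) ⟩
  inversions (upTo n)           ≡⟨ inversions-upTo n ⟩
  0                             ∎)
  where open ≡-Reasoning

inversions-idPerm : ∀ n → inversions (idPerm n) ≡ 0
inversions-idPerm n = trans (inversions-map-suc (upTo n)) (inversions-upTo n)

-- A word of length inversions (w0 n) for w0 n

rotateWord : ℕ → List ℕ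
rotateWord zero    = []
rotateWord (suc m) = 1 ∷ map suc (rotateWord m)

reversalWord : ℕ → List ℕ
reversalWord zero    = []
reversalWord (suc n) = rotateWord n ++ reversalWord n

rotateWord-in-range : ∀ m → IsWordIn (suc m) (rotateWord m)
rotateWord-in-range zero    = []
rotateWord-in-range (suc m) =
  (≤-refl , s≤s z<s) ∷ map⁺ (All.map (λ (1≤i , i<1+m) → m≤n⇒m≤1+n 1≤i , s≤s i<1+m) (rotateWord-in-range m))

reversalWord-in-range : ∀ n → IsWordIn n (reversalWord n)
reversalWord-in-range zero    = []
reversalWord-in-range (suc n) =
  ++⁺ (rotateWord-in-range n) (All.map (λ (1≤i , i<n) → 1≤i , m≤n⇒m≤1+n i<n) (reversalWord-in-range n))

applyWord-map-suc : ∀ y l w → All (1 ≤_) w → applyWord (y ∷ l) (map suc w) ≡ y ∷ applyWord l w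
applyWord-map-suc y l []          _        = refl
applyWord-map-suc y l (suc i ∷ w) (_ ∷ hs) = applyWord-map-suc y (swapAt (suc i) l) w hs

applyWord-rotateWord : ∀ x xs → applyWord (x ∷ xs) (rotateWord (length xs)) ≡ xs ++ [ x ]
applyWord-rotateWord x []       = refl
applyWord-rotateWord x (y ∷ ys) =
  trans (applyWord-map-suc y (x ∷ ys) (rotateWord (length ys)) (All.map proj₁ (rotateWord-in-range _)))
        (cong (y ∷_) (applyWord-rotateWord x ys))

length-swapAt : ∀ i xs → length (swapAt i xs) ≡ length xs
length-swapAt zero          xs           = refl
length-swapAt (suc zero)    []           = refl
length-swapAt (suc zero)    (x ∷ [])     = refl
length-swapAt (suc zero)    (x ∷ y ∷ xs) = refl
length-swapAt (suc (suc i)) []           = refl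
length-swapAt (suc (suc i)) (x ∷ xs)     = cong suc (length-swapAt (suc i) xs)

swapAt-++ : ∀ i xs ys → i < length xs → swapAt i (xs ++ ys) ≡ swapAt i xs ++ ys
swapAt-++ zero          xs           ys _       = refl
swapAt-++ (suc zero)    (x ∷ [])     ys (s≤s ())
swapAt-++ (suc zero)    (x ∷ y ∷ xs) ys _       = refl
swapAt-++ (suc (suc i)) (x ∷ xs)     ys (s≤s h) = cong (x ∷_) (swapAt-++ (suc i) xs ys h)

applyWord-++ : ∀ xs ys w → All (_< length xs) w → applyWord (xs ++ ys) w ≡ applyWord xs w ++ ys
applyWord-++ xs ys []      _        = refl
applyWord-++ xs ys (i ∷ w) (h ∷ hs) = trans (cong (λ l → applyWord l w) (swapAt-++ i xs ys h))
  (applyWord-++ (swapAt i xs) ys w (subst (λ m → All (_< m) w) (sym (length-swapAt i xs)) hs))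

applyWord-reversalWord : ∀ l → applyWord l (reversalWord (length l)) ≡ reverse l
applyWord-reversalWord []       = refl
applyWord-reversalWord (x ∷ xs) = begin
  applyWord (x ∷ xs) (rotateWord (length xs) ++ reversalWord (length xs))
    ≡⟨ foldl-++ _ (x ∷ xs) (rotateWord (length xs)) (reversalWord (length xs)) ⟩
  applyWord (applyWord (x ∷ xs) (rotateWord (length xs))) (reversalWord (length xs))
    ≡⟨ cong (λ l → applyWord l (reversalWord (length xs))) (applyWord-rotateWord x xs) ⟩
  applyWord (xs ++ [ x ]) (reversalWord (length xs))
    ≡⟨ applyWord-++ xs [ x ] (reversalWord (length xs)) (All.map proj₂ (reversalWord-in-range (length xs))) ⟩
  applyWord xs (reversalWord (length xs)) ++ [ x ]
    ≡⟨ cong (_++ [ x ]) (applyWord-reversalWord xs) ⟩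
  reverse xs ++ [ x ]
    ≡⟨ unfold-reverse x xs ⟨
  reverse (x ∷ xs) ∎
  where open ≡-Reasoning

evalWord-reversalWord : ∀ n → evalWord n (reversalWord n) ≡ w0 n
evalWord-reversalWord n = subst (λ m → applyWord (idPerm n) (reversalWord m) ≡ w0 n)
  (trans (length-map suc (upTo n)) (length-upTo n)) (applyWord-reversalWord (idPerm n))

length-rotateWord : ∀ m → length (rotateWord m) ≡ m
length-rotateWord zero    = refl
length-rotateWord (suc m) = cong suc (trans (length-map suc (rotateWord m)) (length-rotateWord m))

length-reversalWord : ∀ n → length (reversalWord n) ≡ inversions (w0 n)
length-reversalWord zero    = refl
length-reversalWord (suc n) = begin
  length (rotateWord n ++ reversalWord n)           ≡⟨ length-++ (rotateWord n) ⟩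
  length (rotateWord n) + length (reversalWord n)   ≡⟨ cong₂ _+_ (length-rotateWord n) (length-reversalWord n) ⟩
  n + inversions (w0 n)                             ≡⟨ inversions-w0-suc n ⟨
  inversions (w0 (suc n))                           ∎
  where open ≡-Reasoning

-- reversalWord n bounds the length of a reduced word of w0 by inversions (w0 n), the most a word can reach.
reduced⇒AscentWord : ∀ n w → IsReducedWord-w0 n w → AscentWord (idPerm n) w
reduced⇒AscentWord n w ((_ , w↦w0) , minimal) = tight⇒AscentWord (idPerm n) w (begin
  length w + inversions (idPerm n)   ≡⟨ cong (length w +_) (inversions-idPerm n) ⟩
  length w + 0                       ≡⟨ +-identityʳ _ ⟩
  length w                           ≤⟨ minimal (reversalWord n) (reversalWord-in-range n , evalWord-reversalWord n) ⟩
  length (reversalWord n)            ≡⟨ length-reversalWord n ⟩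
  inversions (w0 n)                  ≡⟨ cong inversions w↦w0 ⟨
  inversions (applyWord (idPerm n) w) ∎)
  where open ≤-Reasoning

-- A potential that every letter of a reduced word increases

sumTo : (ℕ → ℕ) → ℕ → ℕ
sumTo f zero    = 0
sumTo f (suc t) = f (suc t) + sumTo f t

sumTo-mono-≤ : ∀ {f g} → (∀ δ → f δ ≤ g δ) → ∀ t → sumTo f t ≤ sumTo g t
sumTo-mono-≤ f≤g zero    = z≤n
sumTo-mono-≤ f≤g (suc t) = +-mono-≤ (f≤g (suc t)) (sumTo-mono-≤ f≤g t)

sumTo-+ : ∀ f g t → sumTo (λ δ → f δ + g δ) t ≡ sumTo f t + sumTo g t
sumTo-+ f g zero    = refl
sumTo-+ f g (suc t) = trans (cong (f (suc t) + g (suc t) +_) (sumTo-+ f g t))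
  (solve 4 (λ a b c d → (a :+ b) :+ (c :+ d) := (a :+ c) :+ (b :+ d)) refl (f (suc t)) (g (suc t)) (sumTo f t) (sumTo g t))

sumTo-*ʳ : ∀ f n t → sumTo (λ δ → f δ * n) t ≡ sumTo f t * n
sumTo-*ʳ f n zero    = refl
sumTo-*ʳ f n (suc t) = trans (cong (f (suc t) * n +_) (sumTo-*ʳ f n t)) (sym (*-distribʳ-+ n (f (suc t)) (sumTo f t)))

≤-sumTo : ∀ f {d} t → 1 ≤ d → d ≤ t → f d ≤ sumTo f t
≤-sumTo f zero    (s≤s z≤n) ()
≤-sumTo f {d} (suc t) 1≤d d≤1+t with d ≟ suc t
... | yes refl = m≤m+n _ _
... | no  d≢   = ≤-trans (≤-sumTo f t 1≤d (≤-pred (≤∧≢⇒< d≤1+t d≢))) (m≤n+m _ _)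

gapInversions : ℕ → List ℕ → ℕ
gapInversions δ = pairCount (λ a b → a ≡ᵇ b + δ)

weightedGapInversions : ℕ → List ℕ → ℕ
weightedGapInversions t p = sumTo (λ δ → (t ∸ δ) * gapInversions δ p) t

weightedGapInversions-swapAt-ascent : ∀ t i p (s : AscentSwap i p) →
  weightedGapInversions t p + (t ∸ (high s ∸ low s)) ≤ weightedGapInversions t (swapAt i p)
weightedGapInversions-swapAt-ascent t i p s = begin
  weightedGapInversions t p + (t ∸ d)       ≤⟨ +-monoʳ-≤ (weightedGapInversions t p) new-gap ⟩
  weightedGapInversions t p + sumTo gain t  ≡⟨ sumTo-+ _ gain t ⟨
  sumTo (λ δ → (t ∸ δ) * gapInversions δ p + gain δ) t
    ≤⟨ sumTo-mono-≤ (λ δ → ≤-reflexive (trans (sym (*-distribˡ-+ (t ∸ δ) _ _)) (cong ((t ∸ δ) *_) (gap-swap δ)))) t ⟩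
  weightedGapInversions t (swapAt i p)      ∎
  where
  open ≤-Reasoning
  d = high s ∸ low s
  gain : ℕ → ℕ
  gain δ = (t ∸ δ) * 𝟙 (high s ≡ᵇ low s + δ)
  gap-swap : ∀ δ → gapInversions δ p + 𝟙 (high s ≡ᵇ low s + δ) ≡ gapInversions δ (swapAt i p)
  gap-swap δ = trans (sym (pairCount-swapAt s (λ a b → a ≡ᵇ b + δ)))
    (trans (cong (gapInversions δ (swapAt i p) +_) (𝟙-false low≢high+δ)) (+-identityʳ _))
    where
    low≢high+δ : ¬ T (low s ≡ᵇ high s + δ)
    low≢high+δ t = <-irrefl (≡ᵇ⇒≡ _ _ t) (<-≤-trans (low<high s) (m≤m+n (high s) δ))
  high≡low+d : high s ≡ low s + d
  high≡low+d = sym (m+[n∸m]≡n (<⇒≤ (low<high s)))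
  new-gap : t ∸ d ≤ sumTo gain t
  new-gap with d ≤? t
  ... | yes d≤t = ≤-trans (≤-reflexive (trans (sym (*-identityʳ (t ∸ d)))
                            (cong ((t ∸ d) *_) (sym (𝟙-true (≡⇒≡ᵇ _ _ high≡low+d))))))
                          (≤-sumTo gain t (m<n⇒0<n∸m (low<high s)) d≤t)
  ... | no  d≰t = ≤-trans (≤-reflexive (m≤n⇒m∸n≡0 (<⇒≤ (≰⇒> d≰t)))) z≤n

potential : ℕ → ℕ → List ℕ → ℕ
potential t k p = sum (take k p) + weightedGapInversions t p

module _ {i p} (s : AscentSwap i p) where

  sum-take-swapAt-gap : sum (take i p) + (high s ∸ low s) ≡ sum (take i (swapAt i p))
  sum-take-swapAt-gap = +-cancelʳ-≡ (low s) _ _ (begin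
    sum (take i p) + (high s ∸ low s) + low s   ≡⟨ +-assoc (sum (take i p)) _ _ ⟩
    sum (take i p) + (high s ∸ low s + low s)   ≡⟨ cong (sum (take i p) +_) (m∸n+n≡m (<⇒≤ (low<high s))) ⟩
    sum (take i p) + high s                     ≡⟨ sum-take-swapAt s ⟨
    sum (take i (swapAt i p)) + low s           ∎)
    where open ≡-Reasoning

  sum-take-swapAt-≤ : ∀ k → sum (take k p) ≤ sum (take k (swapAt i p))
  sum-take-swapAt-≤ k with k ≟ i
  ... | yes refl = ≤-trans (m≤m+n _ _) (≤-reflexive sum-take-swapAt-gap)
  ... | no  k≢i  = ≤-reflexive (sym (sum-take-swapAt-≢ s k k≢i))

  potential-swapAt-≤ : ∀ t k → potential t k p ≤ potential t k (swapAt i p)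
  potential-swapAt-≤ t k = +-mono-≤ (sum-take-swapAt-≤ k)
    (≤-trans (m≤m+n _ _) (weightedGapInversions-swapAt-ascent t i p s))

  -- A letter sᵢ raises the prefix sum by the gap d of the ascent and the weighted term by t ∸ d.
  potential-swapAt-+ : ∀ t → potential t i p + t ≤ potential t i (swapAt i p)
  potential-swapAt-+ t = begin
    S + W + t                ≤⟨ +-monoʳ-≤ (S + W) (m≤n+m∸n t d) ⟩
    S + W + (d + (t ∸ d))    ≡⟨ solve 4 (λ S W d e → S :+ W :+ (d :+ e) := (S :+ d) :+ (W :+ e)) refl S W d (t ∸ d) ⟩
    (S + d) + (W + (t ∸ d))  ≤⟨ +-mono-≤ (≤-reflexive sum-take-swapAt-gap) (weightedGapInversions-swapAt-ascent t i p s) ⟩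
    potential t i (swapAt i p) ∎
    where
    open ≤-Reasoning
    S = sum (take i p)
    W = weightedGapInversions t p
    d = high s ∸ low s

potential-applyWord : ∀ t k p w → AscentWord p w →
  potential t k p + t * occurrences k w ≤ potential t k (applyWord p w)
potential-applyWord t k p []      _ = ≤-reflexive (trans (cong (potential t k p +_) (*-zeroʳ t)) (+-identityʳ _))
potential-applyWord t k p (i ∷ w) (asc , ascs) with i ≟ k
... | yes refl = begin
  potential t i p + t * suc (occurrences i w)        ≡⟨ cong (potential t i p +_) (*-suc t _) ⟩
  potential t i p + (t + t * occurrences i w)        ≡⟨ +-assoc (potential t i p) t _ ⟨
  potential t i p + t + t * occurrences i w          ≤⟨ +-monoˡ-≤ _ (potential-swapAt-+ (ascentSwap i p asc) t) ⟩
  potential t i (swapAt i p) + t * occurrences i w   ≤⟨ potential-applyWord t i (swapAt i p) w ascs ⟩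
  potential t i (applyWord (swapAt i p) w)           ∎
  where open ≤-Reasoning
... | no _ = ≤-trans (+-monoˡ-≤ _ (potential-swapAt-≤ (ascentSwap i p asc) t k))
                     (potential-applyWord t k (swapAt i p) w ascs)

countᵇ-≡ᵇ-+-All : ∀ c δ m xs → All (_≤ m) xs → m + δ < c → countᵇ (λ b → c ≡ᵇ b + δ) xs ≡ 0
countᵇ-≡ᵇ-+-All c δ m []       []       _ = refl
countᵇ-≡ᵇ-+-All c δ m (x ∷ xs) (h ∷ hs) m+δ<c = cong₂ _+_
  (𝟙-false (λ t → <-irrefl (sym (≡ᵇ⇒≡ _ _ t)) (≤-<-trans (+-monoˡ-≤ δ h) m+δ<c)))
  (countᵇ-≡ᵇ-+-All c δ m xs hs m+δ<c)

countᵇ-≡ᵇ-+-w0 : ∀ c δ n → countᵇ (λ b → c ≡ᵇ b + δ) (w0 n) ≤ 1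
countᵇ-≡ᵇ-+-w0 c δ zero    = z≤n
countᵇ-≡ᵇ-+-w0 c δ (suc n) rewrite w0-suc n with c ≟ suc n + δ
... | yes refl = ≤-reflexive (cong₂ _+_ (𝟙-true (≡⇒≡ᵇ (suc n + δ) _ refl)) (countᵇ-≡ᵇ-+-All (suc n + δ) δ n (w0 n) (w0-≤ n) ≤-refl))
... | no  c≢   = ≤-trans (≤-reflexive (cong (_+ countᵇ (λ b → c ≡ᵇ b + δ) (w0 n)) (𝟙-false (c≢ ∘ ≡ᵇ⇒≡ _ _))))
                         (countᵇ-≡ᵇ-+-w0 c δ n)

gapInversions-w0-≤ : ∀ δ n → gapInversions δ (w0 n) ≤ n
gapInversions-w0-≤ δ zero    = z≤n
gapInversions-w0-≤ δ (suc n) rewrite w0-suc n = +-mono-≤ (countᵇ-≡ᵇ-+-w0 (suc n) δ n) (gapInversions-w0-≤ δ n)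

sum-take-≤ : ∀ m k xs → All (_≤ m) xs → sum (take k xs) ≤ k * m
sum-take-≤ m zero    xs       _        = z≤n
sum-take-≤ m (suc k) []       _        = z≤n
sum-take-≤ m (suc k) (x ∷ xs) (h ∷ hs) = +-mono-≤ h (sum-take-≤ m k xs hs)

potential-w0-≤ : ∀ t k n → potential t k (w0 n) ≤ (k + sumTo (t ∸_) t) * n
potential-w0-≤ t k n = begin
  sum (take k (w0 n)) + weightedGapInversions t (w0 n)
    ≤⟨ +-mono-≤ (sum-take-≤ n k (w0 n) (w0-≤ n)) (sumTo-mono-≤ (λ δ → *-monoʳ-≤ (t ∸ δ) (gapInversions-w0-≤ δ n)) t) ⟩
  k * n + sumTo (λ δ → (t ∸ δ) * n) t   ≡⟨ cong (k * n +_) (sumTo-*ʳ (t ∸_) n t) ⟩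
  k * n + sumTo (t ∸_) t * n            ≡⟨ *-distribʳ-+ n k _ ⟨
  (k + sumTo (t ∸_) t) * n              ∎
  where open ≤-Reasoning

*-occurrences-≤ : ∀ t k n w → IsReducedWord-w0 n w → t * occurrences k w ≤ (k + sumTo (t ∸_) t) * n
*-occurrences-≤ t k n w reduced@((_ , w↦w0) , _) = begin
  t * occurrences k w                                      ≤⟨ m≤n+m _ _ ⟩
  potential t k (idPerm n) + t * occurrences k w           ≤⟨ potential-applyWord t k (idPerm n) w (reduced⇒AscentWord n w reduced) ⟩
  potential t k (evalWord n w)                             ≡⟨ cong (potential t k) w↦w0 ⟩
  potential t k (w0 n)                                     ≤⟨ potential-w0-≤ t k n ⟩
  (k + sumTo (t ∸_) t) * n                                 ∎
  where open ≤-Reasoning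

triangle : ℕ → ℕ
triangle zero    = 0
triangle (suc m) = suc m + triangle m

m≤triangle : ∀ m → m ≤ triangle m
m≤triangle zero    = z≤n
m≤triangle (suc m) = m≤m+n (suc m) (triangle m)

triangle-double : ∀ m → triangle m + triangle m ≡ suc m * m
triangle-double zero    = refl
triangle-double (suc m) = begin
  (suc m + triangle m) + (suc m + triangle m)  ≡⟨ solve 2 (λ a t → (a :+ t) :+ (a :+ t) := a :+ a :+ (t :+ t)) refl (suc m) (triangle m) ⟩
  suc m + suc m + (triangle m + triangle m)    ≡⟨ cong (suc m + suc m +_) (triangle-double m) ⟩
  suc m + suc m + suc m * m                    ≡⟨ solve 1 (λ m → (con 1 :+ m) :+ (con 1 :+ m) :+ (con 1 :+ m) :* m
                                                          := (con 2 :+ m) :* (con 1 :+ m)) refl m ⟩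
  suc (suc m) * suc m                          ∎
  where open ≡-Reasoning

sumTo-suc-∸ : ∀ c j → j ≤ c → sumTo (suc c ∸_) j ≡ j + sumTo (c ∸_) j
sumTo-suc-∸ c zero    _   = refl
sumTo-suc-∸ c (suc j) j<c = begin
  (c ∸ j) + sumTo (suc c ∸_) j        ≡⟨ cong₂ _+_ (+-∸-assoc 1 j<c) (sumTo-suc-∸ c j (<⇒≤ j<c)) ⟩
  suc (c ∸ suc j) + (j + sumTo (c ∸_) j)
    ≡⟨ solve 3 (λ a b w → (con 1 :+ a) :+ (b :+ w) := (con 1 :+ b) :+ (a :+ w)) refl (c ∸ suc j) j (sumTo (c ∸_) j) ⟩
  suc j + ((c ∸ suc j) + sumTo (c ∸_) j) ∎
  where open ≡-Reasoning

sumTo-∸-triangle : ∀ m → sumTo (suc m ∸_) (suc m) ≡ triangle m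
sumTo-∸-triangle zero    = refl
sumTo-∸-triangle (suc m) = begin
  (m ∸ m) + sumTo (suc (suc m) ∸_) (suc m)  ≡⟨ cong (_+ sumTo (suc (suc m) ∸_) (suc m)) (n∸n≡0 m) ⟩
  sumTo (suc (suc m) ∸_) (suc m)            ≡⟨ sumTo-suc-∸ (suc m) (suc m) ≤-refl ⟩
  suc m + sumTo (suc m ∸_) (suc m)          ≡⟨ cong (suc m +_) (sumTo-∸-triangle m) ⟩
  suc m + triangle m                        ∎
  where open ≡-Reasoning

triangularSplit : ∀ k → ∃₂ λ m r → r ≤ m × suc k ≡ triangle m + suc r
triangularSplit zero = 0 , 0 , z≤n , refl
triangularSplit (suc k) with triangularSplit k
... | m , r , r≤m , k≡ with m≤n⇒m<n∨m≡n r≤m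
...   | inj₁ r<m  = m , suc r , r<m , trans (cong suc k≡) (sym (+-suc (triangle m) (suc r)))
...   | inj₂ refl = suc r , 0 , z≤n , trans (cong suc k≡)
                      (solve 2 (λ t r → con 1 :+ (t :+ (con 1 :+ r)) := ((con 1 :+ r) :+ t) :+ con 1) refl (triangle r) r)

toℚ : ℕ → ℚ
toℚ a = ℤ.+ a / 1

toℚ≃ : ∀ a → toℚᵘ (toℚ a) ℚᵘ.≃ ℚᵘ.mkℚᵘ (ℤ.+ a) 0
toℚ≃ a = toℚᵘ-fromℚᵘ (ℚᵘ.mkℚᵘ (ℤ.+ a) 0)

toℚ-+ : ∀ a b → toℚ (a + b) ≡ toℚ a ℚ.+ toℚ b
toℚ-+ a b = toℚᵘ-injective (ℚᵘ.≃-trans (toℚ≃ (a + b)) (ℚᵘ.≃-trans (ℚᵘ.*≡* integral)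
  (ℚᵘ.≃-sym (ℚᵘ.≃-trans (toℚᵘ-homo-+ (toℚ a) (toℚ b)) (ℚᵘ.+-cong (toℚ≃ a) (toℚ≃ b))))))
  where
  integral : ℤ.+ (a + b) ℤ.* ℤ.+ 1 ≡ (ℤ.+ a ℤ.* ℤ.+ 1 ℤ.+ ℤ.+ b ℤ.* ℤ.+ 1) ℤ.* ℤ.+ 1
  integral = trans (ℤ.*-identityʳ _) (trans (ℤ.pos-+ a b)
    (sym (trans (ℤ.*-identityʳ _) (cong₂ ℤ._+_ (ℤ.*-identityʳ (ℤ.+ a)) (ℤ.*-identityʳ (ℤ.+ b))))))

toℚ-* : ∀ a b → toℚ (a * b) ≡ toℚ a ℚ.* toℚ b
toℚ-* a b = toℚᵘ-injective (ℚᵘ.≃-trans (toℚ≃ (a * b)) (ℚᵘ.≃-trans (ℚᵘ.*≡* integral)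
  (ℚᵘ.≃-sym (ℚᵘ.≃-trans (toℚᵘ-homo-* (toℚ a) (toℚ b)) (ℚᵘ.*-cong (toℚ≃ a) (toℚ≃ b))))))
  where
  integral : ℤ.+ (a * b) ℤ.* ℤ.+ 1 ≡ (ℤ.+ a ℤ.* ℤ.+ b) ℤ.* ℤ.+ 1
  integral = trans (ℤ.*-identityʳ _) (trans (ℤ.pos-* a b) (sym (ℤ.*-identityʳ _)))

toℚ-mono-≤ : ∀ {a b} → a ≤ b → toℚ a ℚ.≤ toℚ b
toℚ-mono-≤ {a} {b} a≤b = toℚᵘ-cancel-≤ (ℚᵘ.≤-respʳ-≃ (ℚᵘ.≃-sym (toℚ≃ b)) (ℚᵘ.≤-respˡ-≃ (ℚᵘ.≃-sym (toℚ≃ a))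
  (ℚᵘ.*≤* (subst₂ ℤ._≤_ (sym (ℤ.*-identityʳ (ℤ.+ a))) (sym (ℤ.*-identityʳ (ℤ.+ b))) (ℤ.+≤+ a≤b)))))

toℚ-suc-*-1/suc : ∀ m → toℚ (suc m) ℚ.* (ℤ.+ 1 / suc m) ≡ 1ℚ
toℚ-suc-*-1/suc m = toℚᵘ-injective (ℚᵘ.≃-trans (toℚᵘ-homo-* (toℚ (suc m)) (ℤ.+ 1 / suc m))
  (ℚᵘ.≃-trans (ℚᵘ.*-cong (toℚ≃ (suc m)) (toℚᵘ-fromℚᵘ (ℚᵘ.mkℚᵘ (ℤ.+ 1) m))) (ℚᵘ.≃-sym (ℚᵘ.≃-trans (toℚ≃ 1) (ℚᵘ.*≡*
    (trans (ℤ.*-identityˡ _) (trans (cong ℤ.+_ (*-identityˡ (suc m))) (sym (trans (ℤ.*-identityʳ _) (ℤ.*-identityʳ _))))))))))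

toℚ-≤-mixed : ∀ a b c d n → suc d * a ≤ (suc d * c + b) * n →
  toℚ a ℚ.≤ (toℚ c ℚ.+ toℚ b ℚ.* (ℤ.+ 1 / suc d)) ℚ.* toℚ n
toℚ-≤-mixed a b c d n bound = *-cancelˡ-≤-pos (toℚ (suc d)) {{normalize-pos (suc d) 1}}
  (subst₂ ℚ._≤_ (toℚ-* (suc d) a) scaled (toℚ-mono-≤ bound))
  where
  open ≡-Reasoning
  q = ℤ.+ 1 / suc d
  scaled : toℚ ((suc d * c + b) * n) ≡ toℚ (suc d) ℚ.* ((toℚ c ℚ.+ toℚ b ℚ.* q) ℚ.* toℚ n)
  scaled = begin
    toℚ ((suc d * c + b) * n)                                    ≡⟨ toℚ-* (suc d * c + b) n ⟩
    toℚ (suc d * c + b) ℚ.* toℚ n                                ≡⟨ cong (ℚ._* toℚ n) (toℚ-+ (suc d * c) b) ⟩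
    (toℚ (suc d * c) ℚ.+ toℚ b) ℚ.* toℚ n                        ≡⟨ cong₂ (λ x y → (x ℚ.+ y) ℚ.* toℚ n) (toℚ-* (suc d) c) b≡s*bq ⟩
    (toℚ (suc d) ℚ.* toℚ c ℚ.+ toℚ (suc d) ℚ.* (toℚ b ℚ.* q)) ℚ.* toℚ n
                                                       ≡⟨ cong (ℚ._* toℚ n) (ℚ.*-distribˡ-+ (toℚ (suc d)) (toℚ c) _) ⟨
    toℚ (suc d) ℚ.* (toℚ c ℚ.+ toℚ b ℚ.* q) ℚ.* toℚ n             ≡⟨ ℚ.*-assoc (toℚ (suc d)) _ (toℚ n) ⟩
    toℚ (suc d) ℚ.* ((toℚ c ℚ.+ toℚ b ℚ.* q) ℚ.* toℚ n)           ∎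
    where
    b≡s*bq : toℚ b ≡ toℚ (suc d) ℚ.* (toℚ b ℚ.* q)
    b≡s*bq = begin
      toℚ b                              ≡⟨ ℚ.*-identityˡ (toℚ b) ⟨
      1ℚ ℚ.* toℚ b                       ≡⟨ cong (ℚ._* toℚ b) (toℚ-suc-*-1/suc d) ⟨
      toℚ (suc d) ℚ.* q ℚ.* toℚ b        ≡⟨ ℚ.*-assoc (toℚ (suc d)) q (toℚ b) ⟩
      toℚ (suc d) ℚ.* (q ℚ.* toℚ b)      ≡⟨ cong (toℚ (suc d) ℚ.*_) (ℚ.*-comm q (toℚ b)) ⟩
      toℚ (suc d) ℚ.* (toℚ b ℚ.* q)      ∎

block : ℕ → List ℚ
block t = replicate (suc t) (ℤ.+ 1 / suc t)

bBlocks-suc : ∀ j → bBlocks (suc j) ≡ bBlocks j ++ block j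
bBlocks-suc j = begin
  concat (map block (upTo (suc j)))         ≡⟨ cong (concat ∘ map block) (upTo-∷ʳ j) ⟨
  concat (map block (upTo j ++ [ j ]))      ≡⟨ cong concat (map-++ block (upTo j) [ j ]) ⟩
  concat (map block (upTo j) ++ [ block j ]) ≡⟨ concat-++ (map block (upTo j)) [ block j ] ⟨
  bBlocks j ++ (block j ++ [])              ≡⟨ cong (bBlocks j ++_) (++-identityʳ (block j)) ⟩
  bBlocks j ++ block j                      ∎
  where open ≡-Reasoning

bBlocks-+ : ∀ j d → Σ (List ℚ) λ xs → bBlocks (j + d) ≡ bBlocks j ++ xs
bBlocks-+ j zero    = [] , trans (cong bBlocks (+-identityʳ j)) (sym (++-identityʳ (bBlocks j)))
bBlocks-+ j (suc d) with bBlocks-+ j d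
... | xs , eq = xs ++ block (j + d) , (begin
  bBlocks (j + suc d)             ≡⟨ cong bBlocks (+-suc j d) ⟩
  bBlocks (suc (j + d))            ≡⟨ bBlocks-suc (j + d) ⟩
  bBlocks (j + d) ++ block (j + d) ≡⟨ cong (_++ block (j + d)) eq ⟩
  (bBlocks j ++ xs) ++ block (j + d) ≡⟨ ++-assoc (bBlocks j) xs _ ⟩
  bBlocks j ++ xs ++ block (j + d) ∎)
  where open ≡-Reasoning

length-bBlocks : ∀ j → length (bBlocks j) ≡ triangle j
length-bBlocks zero    = refl
length-bBlocks (suc j) = begin
  length (bBlocks (suc j))                  ≡⟨ cong length (bBlocks-suc j) ⟩
  length (bBlocks j ++ block j)             ≡⟨ length-++ (bBlocks j) ⟩
  length (bBlocks j) + length (block j)     ≡⟨ cong₂ _+_ (length-bBlocks j) (length-replicate (suc j)) ⟩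
  triangle j + suc j                        ≡⟨ +-comm (triangle j) (suc j) ⟩
  triangle (suc j)                          ∎
  where open ≡-Reasoning

take-length-++ : ∀ {A : Set} (xs : List A) r ys → take (length xs + r) (xs ++ ys) ≡ xs ++ take r ys
take-length-++ []       r ys = refl
take-length-++ (x ∷ xs) r ys = cong (x ∷_) (take-length-++ xs r ys)

take-replicate-++ : ∀ {A : Set} (q : A) {r c} ys → r ≤ c → take r (replicate c q ++ ys) ≡ replicate r q
take-replicate-++ q ys z≤n       = refl
take-replicate-++ q ys (s≤s r≤c) = cong (q ∷_) (take-replicate-++ q ys r≤c)

take-bBlocks : ∀ m r → r ≤ m →
  take (triangle m + suc r) (bBlocks (triangle m + suc r)) ≡ bBlocks m ++ replicate (suc r) (ℤ.+ 1 / suc m)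
take-bBlocks m r r≤m = begin
  take k (bBlocks k)                          ≡⟨ cong (take k) (trans (cong bBlocks (sym 1+m+d≡k)) (proj₂ (bBlocks-+ (suc m) d))) ⟩
  take k (bBlocks (suc m) ++ xs)              ≡⟨ cong (λ l → take k (l ++ xs)) (bBlocks-suc m) ⟩
  take k ((bBlocks m ++ block m) ++ xs)       ≡⟨ cong (take k) (++-assoc (bBlocks m) (block m) xs) ⟩
  take k (bBlocks m ++ block m ++ xs)         ≡⟨ cong (λ i → take (i + suc r) (bBlocks m ++ block m ++ xs)) (length-bBlocks m) ⟨
  take (length (bBlocks m) + suc r) (bBlocks m ++ block m ++ xs)
                                              ≡⟨ take-length-++ (bBlocks m) (suc r) (block m ++ xs) ⟩
  bBlocks m ++ take (suc r) (block m ++ xs)   ≡⟨ cong (bBlocks m ++_) (take-replicate-++ _ xs (s≤s r≤m)) ⟩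
  bBlocks m ++ replicate (suc r) (ℤ.+ 1 / suc m) ∎
  where
  open ≡-Reasoning
  k = triangle m + suc r
  d = k ∸ suc m
  1+m+d≡k : suc m + d ≡ k
  1+m+d≡k = m+[n∸m]≡n (≤-trans (s≤s (≤-trans (m≤triangle m) (m≤m+n _ r))) (≤-reflexive (sym (+-suc (triangle m) r))))
  xs = proj₁ (bBlocks-+ (suc m) d)

sumℚ : List ℚ → ℚ
sumℚ = foldr ℚ._+_ 0ℚ

sumℚ-++ : ∀ xs ys → sumℚ (xs ++ ys) ≡ sumℚ xs ℚ.+ sumℚ ys
sumℚ-++ []       ys = sym (ℚ.+-identityˡ (sumℚ ys))
sumℚ-++ (x ∷ xs) ys = trans (cong (x ℚ.+_) (sumℚ-++ xs ys)) (sym (ℚ.+-assoc x (sumℚ xs) (sumℚ ys)))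

sumℚ-replicate : ∀ c q → sumℚ (replicate c q) ≡ toℚ c ℚ.* q
sumℚ-replicate zero    q = sym (ℚ.*-zeroˡ q)
sumℚ-replicate (suc c) q = begin
  q ℚ.+ sumℚ (replicate c q)    ≡⟨ cong₂ ℚ._+_ (sym (ℚ.*-identityˡ q)) (sumℚ-replicate c q) ⟩
  1ℚ ℚ.* q ℚ.+ toℚ c ℚ.* q      ≡⟨ ℚ.*-distribʳ-+ q 1ℚ (toℚ c) ⟨
  (1ℚ ℚ.+ toℚ c) ℚ.* q          ≡⟨ cong (ℚ._* q) (toℚ-+ 1 c) ⟨
  toℚ (suc c) ℚ.* q             ∎
  where open ≡-Reasoning

sumℚ-bBlocks : ∀ j → sumℚ (bBlocks j) ≡ toℚ j
sumℚ-bBlocks zero    = refl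
sumℚ-bBlocks (suc j) = begin
  sumℚ (bBlocks (suc j))            ≡⟨ cong sumℚ (bBlocks-suc j) ⟩
  sumℚ (bBlocks j ++ block j)       ≡⟨ sumℚ-++ (bBlocks j) (block j) ⟩
  sumℚ (bBlocks j) ℚ.+ sumℚ (block j) ≡⟨ cong₂ ℚ._+_ (sumℚ-bBlocks j) (trans (sumℚ-replicate (suc j) _) (toℚ-suc-*-1/suc j)) ⟩
  toℚ j ℚ.+ 1ℚ                      ≡⟨ toℚ-+ j 1 ⟨
  toℚ (j + 1)                       ≡⟨ cong toℚ (+-comm j 1) ⟩
  toℚ (suc j)                       ∎
  where open ≡-Reasoning

sumB-triangle : ∀ m r → r ≤ m → sumB (triangle m + suc r) ≡ toℚ m ℚ.+ toℚ (suc r) ℚ.* (ℤ.+ 1 / suc m)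
sumB-triangle m r r≤m = begin
  sumℚ (take (triangle m + suc r) (bBlocks (triangle m + suc r)))  ≡⟨ cong sumℚ (take-bBlocks m r r≤m) ⟩
  sumℚ (bBlocks m ++ replicate (suc r) (ℤ.+ 1 / suc m))           ≡⟨ sumℚ-++ (bBlocks m) _ ⟩
  sumℚ (bBlocks m) ℚ.+ sumℚ (replicate (suc r) (ℤ.+ 1 / suc m))   ≡⟨ cong₂ ℚ._+_ (sumℚ-bBlocks m) (sumℚ-replicate (suc r) _) ⟩
  toℚ m ℚ.+ toℚ (suc r) ℚ.* (ℤ.+ 1 / suc m)                       ∎
  where open ≡-Reasoning

occurrences-≤-sumB : ∀ m r n w → r ≤ m → IsReducedWord-w0 n w →
  toℚ (occurrences (triangle m + suc r) w) ℚ.≤ sumB (triangle m + suc r) ℚ.* toℚ n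
occurrences-≤-sumB m r n w r≤m reduced rewrite sumB-triangle m r r≤m =
  toℚ-≤-mixed (occurrences k w) (suc r) m m n
    (subst (λ c → suc m * occurrences k w ≤ c * n) total-weight (*-occurrences-≤ (suc m) k n w reduced))
  where
  k = triangle m + suc r
  total-weight : k + sumTo (suc m ∸_) (suc m) ≡ suc m * m + suc r
  total-weight = begin
    triangle m + suc r + sumTo (suc m ∸_) (suc m)  ≡⟨ cong (k +_) (sumTo-∸-triangle m) ⟩
    triangle m + suc r + triangle m                ≡⟨ solve 2 (λ t s → t :+ s :+ t := t :+ t :+ s) refl (triangle m) (suc r) ⟩
    triangle m + triangle m + suc r                ≡⟨ cong (_+ suc r) (triangle-double m) ⟩
    suc m * m + suc r                              ∎
    where open ≡-Reasoning

proposition3p2 : (k n : ℕ) → 1 ≤ k → k < n → (w : List ℕ) → IsReducedWord-w0 n w →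
    (ℤ.+ occurrences k w / 1) ℚ.≤ sumB k ℚ.* (ℤ.+ n / 1)
proposition3p2 zero    n () _ w reduced
proposition3p2 (suc k) n _  _ w reduced with triangularSplit k
... | m , r , r≤m , k≡ =
  subst (λ k → toℚ (occurrences k w) ℚ.≤ sumB k ℚ.* toℚ n) (sym k≡) (occurrences-≤-sumB m r n w r≤m reduced)
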